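{- Let $r\ge 3$ and $n=a(r+1)+b$ with integers $a\ge1$ and $0\le b\le r$. Then \[ 1+\frac{n}{r-1}(2^r-2)\le a(2^{r+1}-1)+2^b, \] with strict inequality unless $r=3$ and $n=6$. -}

module Defs where

open import Data.Nat as ℕ using (ℕ; zero; suc; _∸_; _^_; _≤_; _*_; _+_)
open import Data.Integer using (+_)
open import Data.Rational using (ℚ; _/_)

-- For r ≥ 2 (the only case used) this is the honest quotient; for r ≤ 1
-- (division by zero, never used since r ≥ 3) we arbitrarily return x / 1.
divPred : ℕ → ℕ → ℚ
divPred x zero          = (+ x) / 1
divPred x (suc zero)    = (+ x) / 1
divPred x (suc (suc k)) = (+ x) / suc k

-- Clear the denominator r − 1 and write r = 3 + k, m = 2 ^ r − 2 (so 2 ^ (r + 1) − 1 = 2m + 3).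
-- Each of the a full blocks of r + 1 contributes (r − 1)(2m + 3) − (r + 1)m = km + 3k + 6 > 0
-- to the difference of the two sides, so everything reduces to the remainder inequality
-- (r − 1) + bm ≤ (r − 1) 2 ^ b + (km + 3k + 6). For k ≥ 2 it holds with room to spare, since
-- r − 1 ≥ 4 makes (r − 1) 2 ^ b grow faster than (b − k) 2 ^ r; the cases r = 3, 4 are a finite
-- check, which also shows that equality occurs only for r = 3, b = 2 and a single block.
module Submission where

open import Defs
open import Data.Nat as ℕ using (ℕ; zero; suc; _∸_; _^_; _*_; _+_; z≤n; s≤s; _≤?_; _≟_)
open import Data.Nat.Properties
open import Data.Nat.Tactic.RingSolver using (solve; solve-∀)
open import Data.Integer as ℤ using (+_; +≤+; +<+)
import Data.Integer.Properties as ℤ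
open import Data.Rational using (_<_; _≤_; 1ℚ) renaming (_+_ to _+ℚ_)
import Data.Rational as ℚ
open import Data.Rational.Properties using (toℚᵘ-homo-+; toℚᵘ-fromℚᵘ; toℚᵘ-cancel-≤; toℚᵘ-cancel-<)
open import Data.Rational.Unnormalised as ℚᵘ using (ℚᵘ; mkℚᵘ; ↥_; ↧_; 1ℚᵘ; *≤*; *<*; _≃_)
import Data.Rational.Unnormalised.Properties as ℚᵘ
open import Data.List using (_∷_; [])
open import Data.Product using (_×_; _,_)
open import Relation.Nullary using (¬_; yes; no; contradiction)
open import Relation.Nullary.Decidable using (_×-dec_)
open import Relation.Binary.PropositionalEquality

module _ (k x R : ℕ) where
  private
    1+x/d : ℚᵘ
    1+x/d = 1ℚᵘ ℚᵘ.+ mkℚᵘ (+ x) k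

    toℚᵘ-1+x/d : ℚ.toℚᵘ (1ℚ +ℚ (+ x) ℚ./ suc k) ≃ 1+x/d
    toℚᵘ-1+x/d = ℚᵘ.≃-trans (toℚᵘ-homo-+ 1ℚ ((+ x) ℚ./ suc k))
                            (ℚᵘ.+-congʳ 1ℚᵘ (toℚᵘ-fromℚᵘ (mkℚᵘ (+ x) k)))

    toℚᵘ-R/1 : ℚ.toℚᵘ ((+ R) ℚ./ 1) ≃ mkℚᵘ (+ R) 0
    toℚᵘ-R/1 = toℚᵘ-fromℚᵘ (mkℚᵘ (+ R) 0)

    ↥1+x/d*1 : ↥ 1+x/d ℤ.* + 1 ≡ + (suc k + x)
    ↥1+x/d*1 = trans (ℤ.*-identityʳ _) (cong₂ ℤ._+_ (ℤ.*-identityˡ (+ suc k)) (ℤ.*-identityʳ (+ x)))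

    R*↧1+x/d : + R ℤ.* ↧ 1+x/d ≡ + (R * suc k)
    R*↧1+x/d = trans (cong (+ R ℤ.*_) (ℤ.*-identityˡ (+ suc k))) (sym (ℤ.pos-* R (suc k)))

  1+x/d≤R : suc k + x ℕ.≤ R * suc k → 1ℚ +ℚ (+ x) ℚ./ suc k ≤ (+ R) ℚ./ 1
  1+x/d≤R h = toℚᵘ-cancel-≤ (ℚᵘ.≤-respʳ-≃ (ℚᵘ.≃-sym toℚᵘ-R/1) (ℚᵘ.≤-respˡ-≃ (ℚᵘ.≃-sym toℚᵘ-1+x/d)
    (*≤* (subst₂ ℤ._≤_ (sym ↥1+x/d*1) (sym R*↧1+x/d) (+≤+ h)))))

  1+x/d<R : suc k + x ℕ.< R * suc k → 1ℚ +ℚ (+ x) ℚ./ suc k < (+ R) ℚ./ 1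
  1+x/d<R h = toℚᵘ-cancel-< (ℚᵘ.<-respʳ-≃ (ℚᵘ.≃-sym toℚᵘ-R/1) (ℚᵘ.<-respˡ-≃ (ℚᵘ.≃-sym toℚᵘ-1+x/d)
    (*<* (subst₂ ℤ._<_ (sym ↥1+x/d*1) (sym R*↧1+x/d) (+<+ h)))))

n<2^n : ∀ n → n ℕ.< 2 ^ n
n<2^n zero    = s≤s z≤n
n<2^n (suc n) = +-mono-≤ (m^n>0 2 n) (≤-trans (n<2^n n) (m≤m+n (2 ^ n) 0))

2*P∸1≡2*[P∸2]+3 : ∀ {P} → 2 ℕ.≤ P → 2 * P ∸ 1 ≡ 2 * (P ∸ 2) + 3
2*P∸1≡2*[P∸2]+3 (s≤s (s≤s {n = m} z≤n)) = cong (_∸ 1) (2*[2+m]≡1+[2*m+3] m)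
  where
  2*[2+m]≡1+[2*m+3] : ∀ m → 2 * (2 + m) ≡ 1 + (2 * m + 3)
  2*[2+m]≡1+[2*m+3] = solve-∀

μ : ℕ → ℕ
μ k = 2 ^ (3 + k) ∸ 2

2^[4+k]∸1≡2*μ+3 : ∀ k → 2 ^ (3 + k + 1) ∸ 1 ≡ 2 * μ k + 3
2^[4+k]∸1≡2*μ+3 k = trans (cong (λ e → 2 ^ e ∸ 1) (+-comm (3 + k) 1))
                          (2*P∸1≡2*[P∸2]+3 (^-monoʳ-≤ 2 {1} {3 + k} (s≤s z≤n)))

blockGain : ℕ → ℕ → ℕ
blockGain k m = 6 + 3 * k + k * m

b*m≤k*m+[2+k]*2^b : ∀ k b {m} → 2 ℕ.≤ k → m ℕ.≤ 2 ^ (3 + k) → b * m ℕ.≤ k * m + (2 + k) * 2 ^ b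
b*m≤k*m+[2+k]*2^b k b {m} 2≤k m≤P with b ≤? k
... | yes b≤k = ≤-trans (*-monoˡ-≤ m b≤k) (m≤m+n _ _)
... | no b≰k with m≤n⇒∃[o]m+o≡n (≰⇒> b≰k)
... | o , refl = begin
  (suc k + o) * m                        ≡⟨ solve (k ∷ o ∷ m ∷ []) ⟩
  k * m + suc o * m                      ≤⟨ +-monoʳ-≤ (k * m) (*-monoʳ-≤ (suc o) m≤P) ⟩
  k * m + suc o * 2 ^ (3 + k)            ≤⟨ +-monoʳ-≤ (k * m) (*-monoˡ-≤ (2 ^ (3 + k)) (n<2^n o)) ⟩
  k * m + 2 ^ o * 2 ^ (3 + k)            ≡⟨ cong (_+_ (k * m)) (sym (^-distribˡ-+-* 2 o (3 + k))) ⟩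
  k * m + 2 ^ (o + (3 + k))              ≡⟨ cong (λ e → k * m + 2 ^ e) (+-comm o (3 + k)) ⟩
  k * m + 2 * (2 * 2 ^ (suc k + o))      ≡⟨ cong (_+_ (k * m)) (sym (*-assoc 2 2 (2 ^ (suc k + o)))) ⟩
  k * m + 4 * 2 ^ (suc k + o)            ≤⟨ +-monoʳ-≤ (k * m) (*-monoˡ-≤ (2 ^ (suc k + o)) (s≤s (s≤s 2≤k))) ⟩
  k * m + (2 + k) * 2 ^ (suc k + o)      ∎
  where open ≤-Reasoning

remainder-< : ∀ k b → b ℕ.≤ 3 + k → ¬ (k ≡ 0 × b ≡ 2) →
              2 + k + b * μ k ℕ.< (2 + k) * 2 ^ b + blockGain k (μ k)
remainder-< 0 0 _ _ = ≤ᵇ⇒≤ _ _ _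
remainder-< 0 1 _ _ = ≤ᵇ⇒≤ _ _ _
remainder-< 0 2 _ ¬eq = contradiction (refl , refl) ¬eq
remainder-< 0 3 _ _ = ≤ᵇ⇒≤ _ _ _
remainder-< 0 (suc (suc (suc (suc _)))) (s≤s (s≤s (s≤s ()))) _
remainder-< 1 0 _ _ = ≤ᵇ⇒≤ _ _ _
remainder-< 1 1 _ _ = ≤ᵇ⇒≤ _ _ _
remainder-< 1 2 _ _ = ≤ᵇ⇒≤ _ _ _
remainder-< 1 3 _ _ = ≤ᵇ⇒≤ _ _ _
remainder-< 1 4 _ _ = ≤ᵇ⇒≤ _ _ _
remainder-< 1 (suc (suc (suc (suc (suc _))))) (s≤s (s≤s (s≤s (s≤s ())))) _
remainder-< k@(suc (suc _)) b _ _ = begin-strict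
  2 + k + b * μ k                                ≤⟨ +-monoʳ-≤ (2 + k) (b*m≤k*m+[2+k]*2^b k b (s≤s (s≤s z≤n)) (m∸n≤m _ 2)) ⟩
  2 + k + (k * μ k + (2 + k) * 2 ^ b)            <⟨ m<m+n _ (s≤s z≤n) ⟩
  2 + k + (k * μ k + (2 + k) * 2 ^ b) + (4 + 2 * k) ≡⟨ rearrange k (μ k) (2 ^ b) ⟩
  (2 + k) * 2 ^ b + blockGain k (μ k)            ∎
  where
  open ≤-Reasoning
  rearrange : ∀ j n Y → 2 + j + (j * n + (2 + j) * Y) + (4 + 2 * j) ≡ (2 + j) * Y + (6 + 3 * j + j * n)
  rearrange = solve-∀

remainder-≤ : ∀ k b → b ℕ.≤ 3 + k → 2 + k + b * μ k ℕ.≤ (2 + k) * 2 ^ b + blockGain k (μ k)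
remainder-≤ k b b≤r with (k ≟ 0) ×-dec (b ≟ 2)
... | yes (refl , refl) = ≤-refl
... | no k,b≢0,2        = <⇒≤ (remainder-< k b b≤r k,b≢0,2)

blocks-≤ : ∀ k a b → 1 ℕ.≤ a → b ℕ.≤ 3 + k →
           2 + k + b * μ k ℕ.≤ (2 + k) * 2 ^ b + a * blockGain k (μ k)
blocks-≤ k a b (s≤s z≤n) b≤r =
  ≤-trans (remainder-≤ k b b≤r) (+-monoʳ-≤ ((2 + k) * 2 ^ b) (m≤n*m (blockGain k (μ k)) a))

blocks-< : ∀ k a b → 1 ℕ.≤ a → b ℕ.≤ 3 + k → ¬ (k ≡ 0 × a ≡ 1 × b ≡ 2) →
           2 + k + b * μ k ℕ.< (2 + k) * 2 ^ b + a * blockGain k (μ k)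
blocks-< k a b (s≤s z≤n) b≤r ¬eq with (k ≟ 0) ×-dec (b ≟ 2)
... | no k,b≢0,2 =
  <-≤-trans (remainder-< k b b≤r k,b≢0,2) (+-monoʳ-≤ ((2 + k) * 2 ^ b) (m≤n*m (blockGain k (μ k)) a))
blocks-< k (suc zero) b _ b≤r ¬eq | yes (refl , refl) = contradiction (refl , refl , refl) ¬eq
blocks-< k (suc (suc a)) b _ b≤r ¬eq | yes (refl , refl) =
  ≤-<-trans (remainder-≤ 0 2 b≤r) (+-monoʳ-< ((2 + 0) * 2 ^ 2) (m<m+n (blockGain 0 (μ 0)) (s≤s z≤n)))

-- With e = 1 this is the strict inequality, as x < y unfolds to 1 + x ≤ y.
reduce-to-remainder : ∀ k a b e →
  e + (2 + k + b * μ k) ℕ.≤ (2 + k) * 2 ^ b + a * blockGain k (μ k) →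
  e + (2 + k + (a * (3 + k + 1) + b) * μ k) ℕ.≤ (a * (2 ^ (3 + k + 1) ∸ 1) + 2 ^ b) * (2 + k)
reduce-to-remainder k a b e h = begin
  e + (2 + k + (a * (3 + k + 1) + b) * μ k)                        ≡⟨ split-lhs e k a b (μ k) ⟩
  a * ((4 + k) * μ k) + (e + (2 + k + b * μ k))                     ≤⟨ +-monoʳ-≤ (a * ((4 + k) * μ k)) h ⟩
  a * ((4 + k) * μ k) + ((2 + k) * 2 ^ b + a * blockGain k (μ k))   ≡⟨ split-rhs k a (μ k) (2 ^ b) ⟩
  (a * (2 * μ k + 3) + 2 ^ b) * (2 + k)                             ≡⟨ cong (λ t → (a * t + 2 ^ b) * (2 + k)) (sym (2^[4+k]∸1≡2*μ+3 k)) ⟩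
  (a * (2 ^ (3 + k + 1) ∸ 1) + 2 ^ b) * (2 + k)                     ∎
  where
  open ≤-Reasoning
  split-lhs : ∀ e k a b m → e + (2 + k + (a * (3 + k + 1) + b) * m) ≡ a * ((4 + k) * m) + (e + (2 + k + b * m))
  split-lhs = solve-∀
  split-rhs : ∀ k a m X → a * ((4 + k) * m) + ((2 + k) * X + a * (6 + 3 * k + k * m)) ≡ (a * (2 * m + 3) + X) * (2 + k)
  split-rhs = solve-∀

lemma5p2 : (r a b n : ℕ) → 3 ℕ.≤ r → 1 ℕ.≤ a → b ℕ.≤ r → n ≡ a * (r + 1) + b →
  let lhs = 1ℚ +ℚ divPred (n * (2 ^ r ∸ 2)) r
      rhs = (+ (a * (2 ^ (r + 1) ∸ 1) + 2 ^ b)) Data.Rational./ 1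
  in (lhs ≤ rhs) × (¬ (r ≡ 3 × n ≡ 6) → lhs < rhs)
lemma5p2 r a b n (s≤s (s≤s (s≤s (z≤n {k})))) 1≤a b≤r refl =
  1+x/d≤R (suc k) x R (reduce-to-remainder k a b 0 (blocks-≤ k a b 1≤a b≤r)) ,
  λ ¬r≡3×n≡6 → 1+x/d<R (suc k) x R (reduce-to-remainder k a b 1 (blocks-< k a b 1≤a b≤r
    λ { (refl , refl , refl) → ¬r≡3×n≡6 (refl , refl) }))
  where
  x R : ℕ
  x = (a * (3 + k + 1) + b) * μ k
  R = a * (2 ^ (3 + k + 1) ∸ 1) + 2 ^ b
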